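{- Let $r\in\mathbb N$, $\epsilon\in(0,1)$, let $\mathcal V\subseteq\mathbb F_2^n$ be a linear subspace and $X\subseteq\mathcal V$, and define $\alpha_X=|X|/|\mathcal V|$. Then there exists an affine subspace $\mathcal V'\subseteq\mathcal V$ such that: 1. $\dim(\mathcal V')\ge\dim(\mathcal V)-r\epsilon^{ -1}\log_2(1/\alpha_X)$; 2. the set $X'=X\cap\mathcal V'$ satisfies $|X'|/|\mathcal V'|\ge\alpha_X$, and $X'$ is $(r,\epsilon)$-algebraically spread within $\mathcal V'$.
   Context: For an affine subspace $\mathcal W\subseteq\mathbb F_2^n$, a subset $A\subseteq\mathcal W$ is $(r,\epsilon)$-algebraically spread within $\mathcal W$ if for every affine subspace $\mathcal W'\subseteq\mathcal W$ with $\dim(\mathcal W')\ge\dim(\mathcal W)-r$ one has $\frac{|A\cap\mathcal W'|}{|\mathcal W'|}\le(1+\epsilon)\frac{|A|}{|\mathcal W|}$.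
   Formalization: The parameter ε ranges over the rationals in (0,1) rather than the reals. -}

module Defs where

open import Data.Bool using (Bool; true; false; _xor_; if_then_else_; _∧_)
open import Data.Bool.Properties using () renaming (_≟_ to _≟B_)
open import Data.Nat using (ℕ; zero; suc; _+_; _*_; _≤_)
open import Data.List using (List; []; _∷_; _++_; map)
open import Data.Nat.ListAction using (sum)
open import Data.Bool.ListAction using (any)
open import Data.Vec using (Vec; []; _∷_; replicate; zipWith)
open import Data.Vec.Properties using (≡-dec)
open import Relation.Binary.PropositionalEquality using (_≡_)
open import Relation.Nullary.Decidable using (⌊_⌋)

-- Vectors of F₂ⁿ are Vec Bool n (false = 0, true = 1); addition is xor.
𝟘 : (n : ℕ) → Vec Bool n
𝟘 n = replicate n false

_⊕_ : {n : ℕ} → Vec Bool n → Vec Bool n → Vec Bool n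
_⊕_ = zipWith _xor_

allVecs : (n : ℕ) → List (Vec Bool n)
allVecs zero    = [] ∷ []
allVecs (suc n) = map (false ∷_) (allVecs n) ++ map (true ∷_) (allVecs n)

combo : {n d : ℕ} → Vec Bool d → Vec (Vec Bool n) d → Vec Bool n
combo {n} []       []       = 𝟘 n
combo     (c ∷ cs) (v ∷ vs) = if c then v ⊕ combo cs vs else combo cs vs

Subset : ℕ → Set
Subset n = Vec Bool n → Bool

∣_∣ : {n : ℕ} → Subset n → ℕ
∣_∣ {n} A = sum (map (λ x → if A x then 1 else 0) (allVecs n))

_∩_ : {n : ℕ} → Subset n → Subset n → Subset n
(A ∩ B) x = A x ∧ B x

_⊆_ : {n : ℕ} → Subset n → Subset n → Set
A ⊆ B = ∀ x → A x ≡ true → B x ≡ true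

record AffSub (n d : ℕ) : Set where
  field
    base  : Vec Bool n
    gens  : Vec (Vec Bool n) d
    indep : (c : Vec Bool d) → combo c gens ≡ 𝟘 n → c ≡ 𝟘 d

pts : {n d : ℕ} → AffSub n d → Subset n
pts {n} {d} W x =
  any (λ c → ⌊ ≡-dec _≟B_ x (AffSub.base W ⊕ combo c (AffSub.gens W)) ⌋) (allVecs d)

IsLinear : {n d : ℕ} → AffSub n d → Set
IsLinear {n} W = AffSub.base W ≡ 𝟘 n

-- (r, ε)-algebraically spread within W, with ε = p / q:
-- for every affine W' ⊆ W with dim W' ≥ dim W - r,
--   |A ∩ W'| / |W'| ≤ (1 + p/q) |A| / |W|   (cleared of denominators).
AlgSpread : {n d : ℕ} → (r p q : ℕ) → AffSub n d → Subset n → Set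
AlgSpread {n} {d} r p q W A =
  ∀ {d'} (W' : AffSub n d') → pts W' ⊆ pts W → d ≤ d' + r →
  q * ∣ A ∩ pts W' ∣ * ∣ pts W ∣ ≤ (q + p) * ∣ A ∣ * ∣ pts W' ∣

-- Density increment.  Put α_S = ∣X ∩ S∣ / ∣S∣.  Starting from W = V, as long as X ∩ W is
-- not (r, p/q)-spread within W, some affine W′ ⊆ W of codimension at most r in W has
-- α_W′ > (1 + p/q) α_W; replace W by W′.  The density never drops below α_V, and since
-- (1 + p/q)^q ≥ 2^p for p ≤ q, after losing Δ dimensions α_W^(rq) ≥ 2^(Δp) α_V^(rq);
-- as α_W ≤ 1 this bounds Δ.  The iteration stops because ∣W∣ strictly decreases, and
-- spreadness is decidable since F₂ⁿ has only finitely many affine subspaces.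

module Submission where

open import Defs
open import Data.Bool using (Bool; true; false; if_then_else_; _∨_)
open import Data.Bool.Properties
  using (xor-assoc; xor-comm; xor-identityˡ; xor-identityʳ; xor-same; ∧-zeroʳ; T-≡)
  renaming (_≟_ to _≟B_)
open import Data.Empty using (⊥)
open import Data.List using (List; []; _∷_; _++_; map; length)
open import Data.List.Membership.Propositional using (_∈_; lose)
open import Data.List.Membership.Propositional.Properties using (∈-++⁺ˡ; ∈-++⁺ʳ; ∈-map⁺)
open import Data.List.Properties using (length-map; length-++)
open import Data.List.Relation.Unary.Any using (here; there; satisfied)
open import Data.List.Relation.Unary.Any.Properties using (any⁺; any⁻)
open import Data.Nat
  using (ℕ; zero; suc; _+_; _*_; _∸_; _^_; _≤_; _<_; _≤?_; _<?_; z≤n; s≤s; NonZero; >-nonZero)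
open import Data.Nat.Induction using (<-wellFounded)
open import Data.Nat.ListAction using (sum)
open import Data.Nat.Properties
open import Data.Nat.Tactic.RingSolver using (solve-∀)
open import Data.Product using (Σ; ∃; _×_; _,_; proj₂)
open import Data.Sum using (_⊎_; inj₁; inj₂)
open import Data.Vec using (Vec; []; _∷_)
open import Data.Vec.Properties
  using (≡-dec; ∷-injectiveʳ; zipWith-assoc; zipWith-comm; zipWith-identityˡ; zipWith-identityʳ)
open import Function.Base using (_∘_)
open import Function.Bundles using (Equivalence)
open import Induction.WellFounded using (Acc; acc)
open import Relation.Binary.PropositionalEquality
open import Relation.Nullary using (Dec; yes; no)
open import Relation.Nullary.Decidable
  using (map′; _×-dec_; _⊎-dec_; _→-dec_; ¬?; decidable-stable; toWitness; fromWitness)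
open import Relation.Unary using (Decidable)

open AffSub

variable
  n d : ℕ

⊕-assoc : (x y z : Vec Bool n) → (x ⊕ y) ⊕ z ≡ x ⊕ (y ⊕ z)
⊕-assoc = zipWith-assoc xor-assoc

⊕-comm : (x y : Vec Bool n) → x ⊕ y ≡ y ⊕ x
⊕-comm = zipWith-comm xor-comm

⊕-identityˡ : (x : Vec Bool n) → 𝟘 n ⊕ x ≡ x
⊕-identityˡ = zipWith-identityˡ xor-identityˡ

⊕-identityʳ : (x : Vec Bool n) → x ⊕ 𝟘 n ≡ x
⊕-identityʳ = zipWith-identityʳ xor-identityʳ

x⊕x≡𝟘 : (x : Vec Bool n) → x ⊕ x ≡ 𝟘 n
x⊕x≡𝟘 []      = refl
x⊕x≡𝟘 (a ∷ x) = cong₂ _∷_ (xor-same a) (x⊕x≡𝟘 x)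

x⊕[x⊕y]≡y : (x y : Vec Bool n) → x ⊕ (x ⊕ y) ≡ y
x⊕[x⊕y]≡y {n} x y = begin
  x ⊕ (x ⊕ y) ≡⟨ ⊕-assoc x x y ⟨
  (x ⊕ x) ⊕ y ≡⟨ cong (_⊕ y) (x⊕x≡𝟘 x) ⟩
  𝟘 n ⊕ y     ≡⟨ ⊕-identityˡ y ⟩
  y           ∎
  where open ≡-Reasoning

x⊕[y⊕z]≡y⊕[x⊕z] : (x y z : Vec Bool n) → x ⊕ (y ⊕ z) ≡ y ⊕ (x ⊕ z)
x⊕[y⊕z]≡y⊕[x⊕z] x y z = begin
  x ⊕ (y ⊕ z) ≡⟨ ⊕-assoc x y z ⟨
  (x ⊕ y) ⊕ z ≡⟨ cong (_⊕ z) (⊕-comm x y) ⟩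
  (y ⊕ x) ⊕ z ≡⟨ ⊕-assoc y x z ⟩
  y ⊕ (x ⊕ z) ∎
  where open ≡-Reasoning

⊕-cancelˡ : (x y z : Vec Bool n) → x ⊕ y ≡ x ⊕ z → y ≡ z
⊕-cancelˡ x y z eq = begin
  y           ≡⟨ x⊕[x⊕y]≡y x y ⟨
  x ⊕ (x ⊕ y) ≡⟨ cong (x ⊕_) eq ⟩
  x ⊕ (x ⊕ z) ≡⟨ x⊕[x⊕y]≡y x z ⟩
  z           ∎
  where open ≡-Reasoning

combo-⊕ : (c c′ : Vec Bool d) (vs : Vec (Vec Bool n) d) →
          combo (c ⊕ c′) vs ≡ combo c vs ⊕ combo c′ vs
combo-⊕ {n = n} [] [] [] = sym (⊕-identityʳ (𝟘 n))
combo-⊕ (false ∷ c) (false ∷ c′) (v ∷ vs) = combo-⊕ c c′ vs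
combo-⊕ (false ∷ c) (true ∷ c′) (v ∷ vs) =
  trans (cong (v ⊕_) (combo-⊕ c c′ vs)) (x⊕[y⊕z]≡y⊕[x⊕z] v (combo c vs) (combo c′ vs))
combo-⊕ (true ∷ c) (false ∷ c′) (v ∷ vs) =
  trans (cong (v ⊕_) (combo-⊕ c c′ vs)) (sym (⊕-assoc v (combo c vs) (combo c′ vs)))
combo-⊕ (true ∷ c) (true ∷ c′) (v ∷ vs) = begin
  combo (c ⊕ c′) vs                  ≡⟨ combo-⊕ c c′ vs ⟩
  C ⊕ C′                             ≡⟨ x⊕[x⊕y]≡y v (C ⊕ C′) ⟨
  v ⊕ (v ⊕ (C ⊕ C′))                 ≡⟨ cong (v ⊕_) (x⊕[y⊕z]≡y⊕[x⊕z] v C C′) ⟩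
  v ⊕ (C ⊕ (v ⊕ C′))                 ≡⟨ ⊕-assoc v C (v ⊕ C′) ⟨
  (v ⊕ C) ⊕ (v ⊕ C′)                 ∎
  where
  open ≡-Reasoning
  C = combo c vs
  C′ = combo c′ vs

combo-𝟘 : (vs : Vec (Vec Bool n) d) → combo (𝟘 d) vs ≡ 𝟘 n
combo-𝟘 []       = refl
combo-𝟘 (v ∷ vs) = combo-𝟘 vs

count : {A : Set} → (A → Bool) → List A → ℕ
count S xs = sum (map (λ x → if S x then 1 else 0) xs)

module _ {A : Set} where

  count-cong : {S T : A → Bool} → (∀ x → S x ≡ T x) → (xs : List A) → count S xs ≡ count T xs
  count-cong S≗T []       = refl
  count-cong S≗T (x ∷ xs) =
    cong₂ _+_ (cong (λ b → if b then 1 else 0) (S≗T x)) (count-cong S≗T xs)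

  count-mono : {S T : A → Bool} → (∀ x → S x ≡ true → T x ≡ true) → (xs : List A) →
               count S xs ≤ count T xs
  count-mono S⊆T [] = z≤n
  count-mono {S} S⊆T (x ∷ xs) with S x in Sx
  ... | false = ≤-trans (count-mono S⊆T xs) (m≤n+m _ _)
  ... | true rewrite S⊆T x Sx = s≤s (count-mono S⊆T xs)

  count-∨ : {S T : A → Bool} → (∀ x → S x ≡ true → T x ≡ true → ⊥) → (xs : List A) →
            count (λ x → S x ∨ T x) xs ≡ count S xs + count T xs
  count-∨ disj [] = refl
  count-∨ {S} {T} disj (x ∷ xs) with S x in Sx | T x in Tx
  ... | true  | true  with () ← disj x Sx Tx
  ... | true  | false = cong suc (count-∨ disj xs)
  ... | false | true  = trans (cong suc (count-∨ disj xs)) (sym (+-suc _ _))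
  ... | false | false = count-∨ disj xs

  count≤length : (S : A → Bool) (xs : List A) → count S xs ≤ length xs
  count≤length S []       = z≤n
  count≤length S (x ∷ xs) with S x
  ... | true  = s≤s (count≤length S xs)
  ... | false = m≤n⇒m≤1+n (count≤length S xs)

  count-pos : {S : A → Bool} {x : A} {xs : List A} → x ∈ xs → S x ≡ true → 0 < count S xs
  count-pos (here refl)  Sx rewrite Sx = s≤s z≤n
  count-pos (there x∈xs) Sx = ≤-trans (count-pos x∈xs Sx) (m≤n+m _ _)

length-allVecs : (n : ℕ) → length (allVecs n) ≡ 2 ^ n
length-allVecs zero    = refl
length-allVecs (suc n) = begin
  length (map (false ∷_) (allVecs n) ++ map (true ∷_) (allVecs n))
    ≡⟨ length-++ (map (false ∷_) (allVecs n)) ⟩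
  length (map (false ∷_) (allVecs n)) + length (map (true ∷_) (allVecs n))
    ≡⟨ cong₂ _+_ (length-map _ (allVecs n)) (length-map _ (allVecs n)) ⟩
  length (allVecs n) + length (allVecs n)
    ≡⟨ cong (λ m → m + m) (length-allVecs n) ⟩
  2 ^ n + 2 ^ n
    ≡⟨ cong (2 ^ n +_) (+-identityʳ (2 ^ n)) ⟨
  2 ^ suc n ∎
  where open ≡-Reasoning

∣∣≤2^n : (S : Subset n) → ∣ S ∣ ≤ 2 ^ n
∣∣≤2^n {n} S = subst (∣ S ∣ ≤_) (length-allVecs n) (count≤length S (allVecs n))

∣∣-mono : {S T : Subset n} → S ⊆ T → ∣ S ∣ ≤ ∣ T ∣
∣∣-mono {n} S⊆T = count-mono S⊆T (allVecs n)

∣∣-cong : {S T : Subset n} → (∀ x → S x ≡ T x) → ∣ S ∣ ≡ ∣ T ∣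
∣∣-cong {n} S≗T = count-cong S≗T (allVecs n)

∈-allVecs : (x : Vec Bool n) → x ∈ allVecs n
∈-allVecs []          = here refl
∈-allVecs (false ∷ x) = ∈-++⁺ˡ (∈-map⁺ (false ∷_) (∈-allVecs x))
∈-allVecs {suc n} (true ∷ x) =
  ∈-++⁺ʳ (map (false ∷_) (allVecs n)) (∈-map⁺ (true ∷_) (∈-allVecs x))

∈pts⇒combo : (W : AffSub n d) {x : Vec Bool n} →
             pts W x ≡ true → ∃ λ c → x ≡ base W ⊕ combo c (gens W)
∈pts⇒combo {d = d} W eq with satisfied (any⁻ _ (allVecs d) (Equivalence.from T-≡ eq))
... | c , x≟combo = c , toWitness x≟combo

combo∈pts : (W : AffSub n d) (c : Vec Bool d) → pts W (base W ⊕ combo c (gens W)) ≡ true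
combo∈pts W c = Equivalence.to T-≡ (any⁺ _ (lose (∈-allVecs c) (fromWitness refl)))

base∈pts : (W : AffSub n d) → pts W (base W) ≡ true
base∈pts {n} {d} W = subst (λ x → pts W x ≡ true) b⊕𝟘≡b (combo∈pts W (𝟘 d))
  where
  b⊕𝟘≡b : base W ⊕ combo (𝟘 d) (gens W) ≡ base W
  b⊕𝟘≡b = trans (cong (base W ⊕_) (combo-𝟘 (gens W))) (⊕-identityʳ (base W))

lowerHalf upperHalf : AffSub n (suc d) → AffSub n d
lowerHalf record { base = b ; gens = g ∷ gs ; indep = ind } =
  record { base = b     ; gens = gs ; indep = λ c eq → ∷-injectiveʳ (ind (false ∷ c) eq) }
upperHalf record { base = b ; gens = g ∷ gs ; indep = ind } =
  record { base = b ⊕ g ; gens = gs ; indep = λ c eq → ∷-injectiveʳ (ind (false ∷ c) eq) }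

lowerHalf⊆ : (W : AffSub n (suc d)) → pts (lowerHalf W) ⊆ pts W
lowerHalf⊆ W@record { base = b ; gens = g ∷ gs } x x∈L with ∈pts⇒combo (lowerHalf W) x∈L
... | c , refl = combo∈pts W (false ∷ c)

upperHalf⊆ : (W : AffSub n (suc d)) → pts (upperHalf W) ⊆ pts W
upperHalf⊆ W@record { base = b ; gens = g ∷ gs } x x∈U with ∈pts⇒combo (upperHalf W) x∈U
... | c , refl = subst (λ y → pts W y ≡ true) (sym (⊕-assoc b g (combo c gs))) (combo∈pts W (true ∷ c))

shifted-collision : (b g : Vec Bool n) (gs : Vec (Vec Bool n) d) (c c′ : Vec Bool d) →
                    b ⊕ combo c gs ≡ (b ⊕ g) ⊕ combo c′ gs → combo (true ∷ (c ⊕ c′)) (g ∷ gs) ≡ 𝟘 n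
shifted-collision {n} b g gs c c′ eq = begin
  g ⊕ combo (c ⊕ c′) gs ≡⟨ cong (g ⊕_) (combo-⊕ c c′ gs) ⟩
  g ⊕ (C ⊕ C′)          ≡⟨ x⊕[y⊕z]≡y⊕[x⊕z] g C C′ ⟩
  C ⊕ (g ⊕ C′)          ≡⟨ cong (C ⊕_) C≡g⊕C′ ⟨
  C ⊕ C                 ≡⟨ x⊕x≡𝟘 C ⟩
  𝟘 n                   ∎
  where
  open ≡-Reasoning
  C = combo c gs
  C′ = combo c′ gs
  C≡g⊕C′ : C ≡ g ⊕ C′
  C≡g⊕C′ = ⊕-cancelˡ b C (g ⊕ C′) (trans eq (⊕-assoc b g C′))

halves-disjoint : (W : AffSub n (suc d)) {x : Vec Bool n} →
                  pts (lowerHalf W) x ≡ true → pts (upperHalf W) x ≡ true → ⊥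
halves-disjoint W@record { base = b ; gens = g ∷ gs ; indep = ind } x∈L x∈U
  with ∈pts⇒combo (lowerHalf W) x∈L | ∈pts⇒combo (upperHalf W) x∈U
... | c , refl | c′ , eq with () ← ind (true ∷ (c ⊕ c′)) (shifted-collision b g gs c c′ eq)

2^d≤∣pts∣ : (W : AffSub n d) → 2 ^ d ≤ ∣ pts W ∣
2^d≤∣pts∣ {n} {zero} W = count-pos (∈-allVecs (base W)) (base∈pts W)
2^d≤∣pts∣ {n} {suc d} W = begin
  2 ^ d + (2 ^ d + 0)  ≡⟨ cong (2 ^ d +_) (+-identityʳ (2 ^ d)) ⟩
  2 ^ d + 2 ^ d        ≤⟨ +-mono-≤ (2^d≤∣pts∣ L) (2^d≤∣pts∣ U) ⟩
  ∣ pts L ∣ + ∣ pts U ∣ ≡⟨ count-∨ (λ _ → halves-disjoint W) (allVecs n) ⟨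
  ∣ L∪U ∣              ≤⟨ ∣∣-mono L∪U⊆W ⟩
  ∣ pts W ∣            ∎
  where
  open ≤-Reasoning
  L = lowerHalf W
  U = upperHalf W
  L∪U : Subset n
  L∪U x = pts L x ∨ pts U x
  L∪U⊆W : L∪U ⊆ pts W
  L∪U⊆W x x∈L∪U with pts L x in x∈L | pts U x in x∈U
  ... | true  | _    = lowerHalf⊆ W x x∈L
  ... | false | true = upperHalf⊆ W x x∈U

∣pts∣>0 : (W : AffSub n d) → 0 < ∣ pts W ∣
∣pts∣>0 {d = d} W = ≤-trans (m^n>0 2 d) (2^d≤∣pts∣ W)

dim≤n : AffSub n d → d ≤ n
dim≤n W = ≮⇒≥ λ n<d →
  <⇒≱ (^-monoʳ-< 2 (s≤s (s≤s z≤n)) n<d) (≤-trans (2^d≤∣pts∣ W) (∣∣≤2^n (pts W)))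

Searchable : Set → Set₁
Searchable A = {P : A → Set} → Decidable P → Dec (∃ P)

search-Bool : Searchable Bool
search-Bool P? = map′ (λ { (inj₁ p) → false , p ; (inj₂ p) → true , p })
                      (λ { (false , p) → inj₁ p ; (true , p) → inj₂ p })
                      (P? false ⊎-dec P? true)

search-Vec : {A : Set} → Searchable A → (n : ℕ) → Searchable (Vec A n)
search-Vec search-A zero    P? = map′ ([] ,_) (λ { ([] , p) → p }) (P? [])
search-Vec search-A (suc n) P? =
  map′ (λ (a , v , p) → a ∷ v , p) (λ { (a ∷ v , p) → a , v , p })
       (search-A λ a → search-Vec search-A n λ v → P? (a ∷ v))

search-F₂ⁿ : (n : ℕ) → Searchable (Vec Bool n)
search-F₂ⁿ = search-Vec search-Bool

∀-dec : {A : Set} → Searchable A → {P : A → Set} → Decidable P → Dec (∀ x → P x)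
∀-dec search P? = map′ (λ ∄¬P x → decidable-stable (P? x) (λ ¬Px → ∄¬P (x , ¬Px)))
                       (λ ∀P (x , ¬Px) → ¬Px (∀P x))
                       (¬? (search (λ x → ¬? (P? x))))

_⊆?_ : (S T : Subset n) → Dec (S ⊆ T)
_⊆?_ {n} S T = ∀-dec (search-F₂ⁿ n) λ x → (S x ≟B true) →-dec (T x ≟B true)

Independent : Vec (Vec Bool n) d → Set
Independent {n} {d} vs = (c : Vec Bool d) → combo c vs ≡ 𝟘 n → c ≡ 𝟘 d

independent? : (vs : Vec (Vec Bool n) d) → Dec (Independent vs)
independent? {n} {d} vs =
  ∀-dec (search-F₂ⁿ d) λ c → ≡-dec _≟B_ (combo c vs) (𝟘 n) →-dec ≡-dec _≟B_ c (𝟘 d)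

search-AffSub : (d : ℕ) {Q : Subset n → Set} → Decidable Q → Dec (∃ λ (W : AffSub n d) → Q (pts W))
search-AffSub {n} d {Q} Q? =
  map′ (λ (b , vs , ind , q) → record { base = b ; gens = vs ; indep = ind } , q)
       (λ (W , q) → base W , gens W , indep W , q)
       (search-F₂ⁿ n λ b → search-Vec (search-F₂ⁿ n) d λ vs → independent-with-Q b vs)
  where
  -- pts ignores the independence proof, so the one found by independent? serves for all.
  independent-with-Q : ∀ b vs →
    Dec (Σ (Independent vs) λ ind → Q (pts (record { base = b ; gens = vs ; indep = ind })))
  independent-with-Q b vs with independent? vs
  ... | yes ind = map′ (ind ,_) proj₂ (Q? _)
  ... | no ¬ind = no (λ (ind , _) → ¬ind ind)

[m*n]^o≡m^o*n^o : ∀ m n o → (m * n) ^ o ≡ m ^ o * n ^ o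
[m*n]^o≡m^o*n^o m n zero    = refl
[m*n]^o≡m^o*n^o m n (suc o) = begin
  m * n * (m * n) ^ o       ≡⟨ cong (m * n *_) ([m*n]^o≡m^o*n^o m n o) ⟩
  m * n * (m ^ o * n ^ o)   ≡⟨ interchange m n (m ^ o) (n ^ o) ⟩
  m * m ^ o * (n * n ^ o)   ∎
  where
  open ≡-Reasoning
  interchange : ∀ a b c d → a * b * (c * d) ≡ a * c * (b * d)
  interchange = solve-∀

n^n>0 : ∀ n → 0 < n ^ n
n^n>0 zero    = s≤s z≤n
n^n>0 (suc n) = m^n>0 (suc n) (suc n)

[m+n]^[1+k]≤m^[1+k]+[1+k]*n*[m+n]^k : ∀ m n k → (m + n) ^ suc k ≤ m ^ suc k + suc k * n * (m + n) ^ k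
[m+n]^[1+k]≤m^[1+k]+[1+k]*n*[m+n]^k m n zero = ≤-reflexive (identity m n)
  where
  identity : ∀ m n → (m + n) * 1 ≡ m * 1 + 1 * n * 1
  identity = solve-∀
[m+n]^[1+k]≤m^[1+k]+[1+k]*n*[m+n]^k m n (suc k) = begin
  (m + n) * (m + n) ^ suc k
    ≤⟨ *-monoʳ-≤ (m + n) ([m+n]^[1+k]≤m^[1+k]+[1+k]*n*[m+n]^k m n k) ⟩
  (m + n) * (M + suc k * n * S)
    ≡⟨ expand m n k M S ⟩
  m * M + n * M + suc k * n * ((m + n) * S)
    ≤⟨ +-monoˡ-≤ _ (+-monoʳ-≤ (m * M) (*-monoʳ-≤ n (^-monoˡ-≤ (suc k) (m≤m+n m n)))) ⟩
  m * M + n * (m + n) ^ suc k + suc k * n * (m + n) ^ suc k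
    ≡⟨ collect m n k M ((m + n) ^ suc k) ⟩
  m * M + suc (suc k) * n * (m + n) ^ suc k ∎
  where
  open ≤-Reasoning
  M = m ^ suc k
  S = (m + n) ^ k
  expand : ∀ m n k M S → (m + n) * (M + suc k * n * S) ≡ m * M + n * M + suc k * n * ((m + n) * S)
  expand = solve-∀
  collect : ∀ m n k M T → m * M + n * T + suc k * n * T ≡ m * M + suc (suc k) * n * T
  collect = solve-∀

-- (1 + p/q)^q is nondecreasing in q.  With e = q(1+q+p) and D = (1+q)(q+p) = e + p, the
-- bound D^(1+q) ≤ e^(1+q) + (1+q) p D^q leaves (1+q) q D^q ≤ e^(1+q), which is the claim times q.
[q+p]^q*[1+q]^[1+q]≤q^q*[1+q+p]^[1+q] : ∀ p q →
  (q + p) ^ q * suc q ^ suc q ≤ q ^ q * (suc q + p) ^ suc q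
[q+p]^q*[1+q]^[1+q]≤q^q*[1+q+p]^[1+q] p zero = s≤s z≤n
[q+p]^q*[1+q]^[1+q]≤q^q*[1+q+p]^[1+q] p q@(suc _) = *-cancelˡ-≤ q (begin
  q * ((q + p) ^ q * suc q ^ suc q)   ≡⟨ split-D^q ⟩
  suc q * q * D ^ q                    ≤⟨ +-cancelʳ-≤ _ _ _ (subst (_≤ e ^ suc q + pD^q) split bound) ⟩
  e ^ suc q                            ≡⟨ [m*n]^o≡m^o*n^o q (suc q + p) (suc q) ⟩
  q * q ^ q * (suc q + p) ^ suc q      ≡⟨ *-assoc q (q ^ q) _ ⟩
  q * (q ^ q * (suc q + p) ^ suc q)    ∎)
  where
  open ≤-Reasoning
  e = q * (suc q + p)
  D = suc q * (q + p)
  pD^q = suc q * p * D ^ q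
  bound : D ^ suc q ≤ e ^ suc q + pD^q
  bound = subst (λ z → z ^ suc q ≤ e ^ suc q + suc q * p * z ^ q) (e+p≡D q p)
                ([m+n]^[1+k]≤m^[1+k]+[1+k]*n*[m+n]^k e p q)
    where
    e+p≡D : ∀ q p → q * (suc q + p) + p ≡ suc q * (q + p)
    e+p≡D = solve-∀
  split : D ^ suc q ≡ suc q * q * D ^ q + pD^q
  split = distrib q p (D ^ q)
    where
    distrib : ∀ q p X → suc q * (q + p) * X ≡ suc q * q * X + suc q * p * X
    distrib = solve-∀
  split-D^q : q * ((q + p) ^ q * suc q ^ suc q) ≡ suc q * q * D ^ q
  split-D^q = trans (regroup q ((q + p) ^ q) (suc q ^ q))
                    (cong (suc q * q *_) (sym ([m*n]^o≡m^o*n^o (suc q) (q + p) q)))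
    where
    regroup : ∀ q P Q → q * (P * (suc q * Q)) ≡ suc q * q * (Q * P)
    regroup = solve-∀

2^p*q^q≤[q+p]^q : ∀ {p q} → p ≤ q → 2 ^ p * q ^ q ≤ (q + p) ^ q
2^p*q^q≤[q+p]^q {p} {q} p≤q =
  subst (λ q → 2 ^ p * q ^ q ≤ (q + p) ^ q) (m+[n∸m]≡n p≤q) (from-p (q ∸ p))
  where
  from-p : ∀ m → 2 ^ p * (p + m) ^ (p + m) ≤ (p + m + p) ^ (p + m)
  from-p zero rewrite +-identityʳ p =
    ≤-reflexive (trans (sym ([m*n]^o≡m^o*n^o 2 p p)) (cong (λ m → (p + m) ^ p) (+-identityʳ p)))
  from-p (suc m) rewrite +-suc p m = *-cancelˡ-≤ (Q ^ Q) {{>-nonZero (n^n>0 Q)}} (begin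
    Q ^ Q * (2 ^ p * S)     ≡⟨ rotate (Q ^ Q) (2 ^ p) S ⟩
    S * (2 ^ p * Q ^ Q)     ≤⟨ *-monoʳ-≤ S (from-p m) ⟩
    S * (Q + p) ^ Q         ≡⟨ *-comm S _ ⟩
    (Q + p) ^ Q * S         ≤⟨ [q+p]^q*[1+q]^[1+q]≤q^q*[1+q+p]^[1+q] p Q ⟩
    Q ^ Q * (suc Q + p) ^ suc Q ∎)
    where
    open ≤-Reasoning
    Q = p + m
    S = suc Q ^ suc Q
    rotate : ∀ a b c → a * (b * c) ≡ c * (b * a)
    rotate = solve-∀

m^[r*n]≡[m^n]^r : ∀ m n r → m ^ (r * n) ≡ (m ^ n) ^ r
m^[r*n]≡[m^n]^r m n r = trans (cong (m ^_) (*-comm r n)) (sym (^-*-assoc m n r))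

2^[r*p]*a^[r*q]≤b^[r*q] : ∀ {p q} .{{_ : NonZero q}} r {a b} → p ≤ q → (q + p) * a ≤ q * b →
                          2 ^ (r * p) * a ^ (r * q) ≤ b ^ (r * q)
2^[r*p]*a^[r*q]≤b^[r*q] {p} {q} r {a} {b} p≤q ratio = *-cancelˡ-≤ (q ^ R) {{m^n≢0 q R}} (begin
  q ^ R * (2 ^ (r * p) * a ^ R)   ≡⟨ x*[y*z]≡y*x*z (q ^ R) (2 ^ (r * p)) (a ^ R) ⟩
  2 ^ (r * p) * q ^ R * a ^ R     ≤⟨ *-monoˡ-≤ (a ^ R) 2^[r*p]*q^R≤[q+p]^R ⟩
  (q + p) ^ R * a ^ R             ≡⟨ [m*n]^o≡m^o*n^o (q + p) a R ⟨
  ((q + p) * a) ^ R               ≤⟨ ^-monoˡ-≤ R ratio ⟩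
  (q * b) ^ R                     ≡⟨ [m*n]^o≡m^o*n^o q b R ⟩
  q ^ R * b ^ R                   ∎)
  where
  open ≤-Reasoning
  R = r * q
  x*[y*z]≡y*x*z : ∀ x y z → x * (y * z) ≡ y * x * z
  x*[y*z]≡y*x*z = solve-∀
  2^[r*p]*q^R≤[q+p]^R : 2 ^ (r * p) * q ^ R ≤ (q + p) ^ R
  2^[r*p]*q^R≤[q+p]^R = begin
    2 ^ (r * p) * q ^ R         ≡⟨ cong₂ _*_ (m^[r*n]≡[m^n]^r 2 p r) (m^[r*n]≡[m^n]^r q q r) ⟩
    (2 ^ p) ^ r * (q ^ q) ^ r   ≡⟨ [m*n]^o≡m^o*n^o (2 ^ p) (q ^ q) r ⟨
    (2 ^ p * q ^ q) ^ r         ≤⟨ ^-monoˡ-≤ r (2^p*q^q≤[q+p]^q p≤q) ⟩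
    ((q + p) ^ q) ^ r           ≡⟨ m^[r*n]≡[m^n]^r (q + p) q r ⟨
    (q + p) ^ R                 ∎

cross-≤-trans : ∀ {x N a v b w} → 0 < v → x * v ≤ a * N → a * w ≤ b * v → x * w ≤ b * N
cross-≤-trans {x} {N} {a} {v} {b} {w} v>0 x/N≤a/v a/v≤b/w = *-cancelˡ-≤ v {{>-nonZero v>0}} (begin
  v * (x * w)   ≡⟨ swap v x w ⟩
  w * (x * v)   ≤⟨ *-monoʳ-≤ w x/N≤a/v ⟩
  w * (a * N)   ≡⟨ swap w a N ⟩
  N * (a * w)   ≤⟨ *-monoʳ-≤ N a/v≤b/w ⟩
  N * (b * v)   ≡⟨ swap N b v ⟩
  v * (b * N)   ∎)
  where
  open ≤-Reasoning
  swap : ∀ x y z → x * (y * z) ≡ z * (y * x)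
  swap = solve-∀

n≤o+r⇒m∸o≤m∸n+r : ∀ m {n o r} → n ≤ o + r → m ∸ o ≤ m ∸ n + r
n≤o+r⇒m∸o≤m∸n+r m {n} {o} {r} n≤o+r = m≤n+o⇒m∸n≤o m o (begin
  m                    ≤⟨ m≤n+m∸n m n ⟩
  n + (m ∸ n)          ≤⟨ +-monoˡ-≤ (m ∸ n) n≤o+r ⟩
  o + r + (m ∸ n)      ≡⟨ rearrange o r (m ∸ n) ⟩
  o + (m ∸ n + r)      ∎)
  where
  open ≤-Reasoning
  rearrange : ∀ a b c → a + b + c ≡ a + (c + b)
  rearrange = solve-∀


2^[[m∸o]*p]≤2^[[m∸n]*p]*2^[r*p] : ∀ m {n o} r p → n ≤ o + r →
                                   2 ^ ((m ∸ o) * p) ≤ 2 ^ ((m ∸ n) * p) * 2 ^ (r * p)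
2^[[m∸o]*p]≤2^[[m∸n]*p]*2^[r*p] m {n} {o} r p n≤o+r = begin
  2 ^ ((m ∸ o) * p)                   ≤⟨ ^-monoʳ-≤ 2 (*-monoˡ-≤ p (n≤o+r⇒m∸o≤m∸n+r m n≤o+r)) ⟩
  2 ^ ((m ∸ n + r) * p)               ≡⟨ cong (2 ^_) (*-distribʳ-+ p (m ∸ n) r) ⟩
  2 ^ ((m ∸ n) * p + r * p)           ≡⟨ ^-distribˡ-+-* 2 ((m ∸ n) * p) (r * p) ⟩
  2 ^ ((m ∸ n) * p) * 2 ^ (r * p)     ∎
  where open ≤-Reasoning

^-cross-≤-trans : ∀ R {T E x N a v b w} → 0 < v →
                  T * x ^ R * v ^ R ≤ a ^ R * N ^ R → E * (a * w) ^ R ≤ (b * v) ^ R →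
                  T * E * x ^ R * w ^ R ≤ b ^ R * N ^ R
^-cross-≤-trans R {T} {E} {x} {N} {a} {v} {b} {w} v>0 x/N≤a/v a/v≤b/w =
  cross-≤-trans {T * E * x ^ R} {N ^ R} {E * a ^ R} {v ^ R} {b ^ R} {w ^ R}
                (m^n>0 v {{>-nonZero v>0}} R) scaled (subst₂ _≤_ split ([m*n]^o≡m^o*n^o b v R) a/v≤b/w)
  where
  scaled : T * E * x ^ R * v ^ R ≤ E * a ^ R * N ^ R
  scaled = subst₂ _≤_ (rearrange T E (x ^ R) (v ^ R)) (sym (*-assoc E (a ^ R) _)) (*-monoʳ-≤ E x/N≤a/v)
    where
    rearrange : ∀ t e x y → e * (t * x * y) ≡ t * e * x * y
    rearrange = solve-∀
  split : E * (a * w) ^ R ≡ E * a ^ R * w ^ R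
  split = trans (cong (E *_) ([m*n]^o≡m^o*n^o a w R)) (sym (*-assoc E _ _))

∩-⊆ʳ : (A S : Subset n) → (A ∩ S) ⊆ S
∩-⊆ʳ A S x x∈A∩S with A x
... | true = x∈A∩S

∩-monoʳ : (A : Subset n) {S T : Subset n} → S ⊆ T → (A ∩ S) ⊆ (A ∩ T)
∩-monoʳ A S⊆T x x∈A∩S with A x
... | true = S⊆T x x∈A∩S

∩-absorb : (A : Subset n) {S T : Subset n} → S ⊆ T → ∀ x → ((A ∩ T) ∩ S) x ≡ (A ∩ S) x
∩-absorb A {S} {T} S⊆T x with A x | S x in x∈S
... | false | _     = refl
... | true  | false = ∧-zeroʳ (T x)
... | true  | true  rewrite S⊆T x x∈S = refl

∩-of-⊆ : {A S : Subset n} → A ⊆ S → ∀ x → (A ∩ S) x ≡ A x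
∩-of-⊆ {A = A} {S} A⊆S x with A x in x∈A
... | false = refl
... | true  = A⊆S x x∈A

module _ (r p q : ℕ) {k : ℕ} (W : AffSub n k) (A : Subset n) where

  Denser : (d′ : ℕ) → Subset n → Set
  Denser d′ S = S ⊆ pts W × k ≤ d′ + r × (q + p) * ∣ A ∣ * ∣ S ∣ < q * ∣ A ∩ S ∣ * ∣ pts W ∣

  denser? : (d′ : ℕ) → Decidable (Denser d′)
  denser? d′ S = (S ⊆? pts W) ×-dec (k ≤? d′ + r) ×-dec (_ <? _)

  record Increment : Set where
    constructor increment
    field
      {dim}    : ℕ
      subspace : AffSub n dim
      denser   : Denser dim (pts subspace)

  spread⊎increment : AlgSpread r p q W A ⊎ Increment
  spread⊎increment with anyUpTo? (λ d′ → search-AffSub d′ (denser? d′)) (suc n)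
  ... | yes (_ , _ , W′ , W′-denser) = inj₂ (increment W′ W′-denser)
  ... | no ∄denser = inj₁ λ W′ W′⊆W codim →
    ≮⇒≥ λ gain → ∄denser (_ , s≤s (dim≤n W′) , W′ , W′⊆W , codim , gain)

module DensityIncrement {n : ℕ} (r p q : ℕ) .{{_ : NonZero q}} (p≤q : p ≤ q)
                        (X : Subset n) {d : ℕ} (V : AffSub n d) where

  R : ℕ
  R = r * q

  -- In terms of α_S = ∣X ∩ S∣ / ∣S∣:  α_space ≥ α_V  and  α_space^R ≥ 2^((d ∸ dim) p) α_V^R.
  record Stage : Set where
    constructor stage
    field
      {dim}    : ℕ
      space    : AffSub n dim
      space⊆V  : pts space ⊆ pts V
      dense    : ∣ X ∣ * ∣ pts space ∣ ≤ ∣ X ∩ pts space ∣ * ∣ pts V ∣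
      gain     : 2 ^ ((d ∸ dim) * p) * ∣ X ∣ ^ R * ∣ pts space ∣ ^ R
                 ≤ ∣ X ∩ pts space ∣ ^ R * ∣ pts V ∣ ^ R

  open Stage using (space)

  initial : X ⊆ pts V → Stage
  initial X⊆V = stage V (λ _ x∈V → x∈V) dense gain
    where
    ∣X∩V∣≡∣X∣ : ∣ X ∩ pts V ∣ ≡ ∣ X ∣
    ∣X∩V∣≡∣X∣ = ∣∣-cong (∩-of-⊆ X⊆V)
    dense : ∣ X ∣ * ∣ pts V ∣ ≤ ∣ X ∩ pts V ∣ * ∣ pts V ∣
    dense = ≤-reflexive (cong (_* ∣ pts V ∣) (sym ∣X∩V∣≡∣X∣))
    gain : 2 ^ ((d ∸ d) * p) * ∣ X ∣ ^ R * ∣ pts V ∣ ^ R ≤ ∣ X ∩ pts V ∣ ^ R * ∣ pts V ∣ ^ R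
    gain rewrite n∸n≡0 d | ∣X∩V∣≡∣X∣ =
      ≤-reflexive (cong (_* ∣ pts V ∣ ^ R) (*-identityˡ (∣ X ∣ ^ R)))

  refine : (s : Stage) → Increment r p q (space s) (X ∩ pts (space s)) →
           Σ Stage λ s′ → ∣ pts (space s′) ∣ < ∣ pts (space s) ∣
  refine (stage {k} W W⊆V dense gain) (increment {k′} W′ (W′⊆W , codim , denser)) =
    stage W′ (λ x → W⊆V x ∘ W′⊆W x) dense′ gain′ , w<v
    where
    a = ∣ X ∩ pts W ∣
    v = ∣ pts W ∣
    b = ∣ X ∩ pts W′ ∣
    w = ∣ pts W′ ∣
    ratio : (q + p) * (a * w) < q * (b * v)
    ratio = subst₂ _<_ (*-assoc (q + p) a w)
                       (trans (cong (λ c → q * c * v) (∣∣-cong (∩-absorb X W′⊆W))) (*-assoc q b v))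
                       denser
    aw<bv : a * w < b * v
    aw<bv = *-cancelˡ-< q _ _ (≤-<-trans (*-monoˡ-≤ (a * w) (m≤m+n q p)) ratio)
    w<v : w < v
    w<v = *-cancelˡ-< a _ _ (<-≤-trans aw<bv (*-monoˡ-≤ v (∣∣-mono (∩-monoʳ X W′⊆W))))
    dense′ : ∣ X ∣ * w ≤ b * ∣ pts V ∣
    dense′ = cross-≤-trans {∣ X ∣} {∣ pts V ∣} {a} {v} {b} {w} (∣pts∣>0 W) dense (<⇒≤ aw<bv)
    gain′ : 2 ^ ((d ∸ k′) * p) * ∣ X ∣ ^ R * w ^ R ≤ b ^ R * ∣ pts V ∣ ^ R
    gain′ = ≤-trans
      (*-monoˡ-≤ (w ^ R) (*-monoˡ-≤ (∣ X ∣ ^ R) (2^[[m∸o]*p]≤2^[[m∸n]*p]*2^[r*p] d r p codim)))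
      (^-cross-≤-trans R {2 ^ ((d ∸ k) * p)} {2 ^ (r * p)} {∣ X ∣} {∣ pts V ∣} {a} {v} {b} {w}
                       (∣pts∣>0 W) gain (2^[r*p]*a^[r*q]≤b^[r*q] r p≤q (<⇒≤ ratio)))

  Spread : Stage → Set
  Spread s = AlgSpread r p q (space s) (X ∩ pts (space s))

  iterate : (s : Stage) → Acc _<_ ∣ pts (space s) ∣ → Σ Stage Spread
  iterate s (acc smaller) with spread⊎increment r p q (space s) (X ∩ pts (space s))
  ... | inj₁ spread = s , spread
  ... | inj₂ inc    = let s′ , shrinks = refine s inc in iterate s′ (smaller shrinks)

  codim-bound : (s : Stage) → 2 ^ ((d ∸ Stage.dim s) * p) * ∣ X ∣ ^ R ≤ ∣ pts V ∣ ^ R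
  codim-bound (stage {k} W _ _ gain) =
    *-cancelˡ-≤ (v ^ R) {{m^n≢0 v R {{>-nonZero (∣pts∣>0 W)}}}} (begin
    v ^ R * (T * ∣ X ∣ ^ R)          ≡⟨ *-comm (v ^ R) _ ⟩
    T * ∣ X ∣ ^ R * v ^ R            ≤⟨ gain ⟩
    ∣ X ∩ pts W ∣ ^ R * ∣ pts V ∣ ^ R ≤⟨ *-monoˡ-≤ _ (^-monoˡ-≤ R (∣∣-mono (∩-⊆ʳ X (pts W)))) ⟩
    v ^ R * ∣ pts V ∣ ^ R            ∎)
    where
    open ≤-Reasoning
    v = ∣ pts W ∣
    T = 2 ^ ((d ∸ k) * p)

lemma4p4 : (n r p q : ℕ) → 0 < p → p < q →
    {d : ℕ} (V : AffSub n d) → IsLinear V →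
    (X : Subset n) → X ⊆ pts V →
    ∃ λ d' → Σ (AffSub n d') λ V' →
      pts V' ⊆ pts V
      × 2 ^ ((d ∸ d') * p) * ∣ X ∣ ^ (r * q) ≤ ∣ pts V ∣ ^ (r * q)
      × ∣ X ∣ * ∣ pts V' ∣ ≤ ∣ X ∩ pts V' ∣ * ∣ pts V ∣
      × AlgSpread r p q V' (X ∩ pts V')
lemma4p4 n r p q 0<p p<q V _ X X⊆V =
  let s@(stage V′ V′⊆V dense _) , spread = iterate (initial X⊆V) (<-wellFounded _)
  in  _ , V′ , V′⊆V , codim-bound s , dense , spread
  where open DensityIncrement r p q {{>-nonZero (<-trans 0<p p<q)}} (<⇒≤ p<q) X V
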